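{- Assume axioms C3, SV1 and SV2 hold. In every proof outline, fence actions are globally correct for $\beta$-stable assertions: for every $G\in\mathcal{G}$, every $P\in\mathcal{A}$ and thread $t$, $\{G\cap P\}\ fnc_t\ \{G\}$.
   Context: Setting: transition system $(\mathsf{Act_{ext}},\Sigma,I,T)$ with $T(t,a)\subseteq\Sigma\times\Sigma$; $\operatorname{\mathsf{wlp}}(R,P)=\{\sigma\mid\forall\sigma'.(\sigma,\sigma')\in R\Rightarrow\sigma'\in P\}$, $\operatorname{\mathsf{dis}}(R)=\operatorname{\mathsf{wlp}}(R,\emptyset)$, $R;R'$ relational composition. The memory model provides $\mathit{vmax}(t,a)$ and $\mathit{interf}(t,a)$; $\beta$ is the weakest $R$ with $R;T(t,a)\subseteq T(t,a);R$ and $\mathit{vmax}(t,a)\subseteq\operatorname{\mathsf{wlp}}(R,\mathit{vmax}(t,a))$; a predicate $P$ is $\beta$-stable iff $P\subseteq\operatorname{\mathsf{wlp}}(\beta,P)$. $\mathcal{G}$ is the set of logical combinations of global view-based assertions ($[x\not\approx v]_t=\operatorname{\mathsf{dis}}(T(t,\mathit{Rd}_{|x}[v]))$, $[x\equiv v]_t$, $x_{\uparrow t}=\bigcap_{a\in\mathsf{Act}_{|x}}\mathit{vmax}(t,a)$, $[x=v]_t$, conditional observations); all of these are $\beta$-stable. $\mathcal{A}$ is the set of logical combinations of global assertions and boolean expressions over local registers. $\{P\}\ fnc_t\ \{Q\}$ means $P\subseteq\operatorname{\mathsf{wlp}}(T(t,fence),Q)$. Axioms: C3: $T(t,a)\subseteq\beta;\mathit{interf}(t,a);\beta$.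 SV1: if $\mathit{var}(a)\neq\mathit{var}(b)$, $\mathit{interf}(t',b);T(t,a)\subseteq T(t,a);\mathit{interf}(t',b)$. SV2: if $\mathit{var}(a)\neq\mathit{var}(b)$, $\mathit{vmax}(t,a)\subseteq\operatorname{\mathsf{wlp}}(\mathit{interf}(t',b),\mathit{vmax}(t,a))$. Global correctness (Owicki–Gries interference freedom) of a command $com_{t'}$ with pre-assertion $P$ w.r.t. an assertion $R$ of another thread means $\{R\cap P\}\ com_{t'}\ \{R\}$. -}

module Defs where

open import Level using (Level; _⊔_) renaming (zero to lzero; suc to lsuc)
open import Data.Bool using (Bool; true)
open import Data.Maybe using (Maybe; just; nothing)
open import Data.Product using (Σ; Σ-syntax; ∃-syntax; _×_; _,_)
open import Data.Unit.Polymorphic using (⊤)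
open import Data.Empty.Polymorphic using (⊥)
open import Data.Sum using (_⊎_)
open import Relation.Nullary using (¬_)
open import Relation.Binary.PropositionalEquality using (_≡_)

module _ {St : Set} where

  Pred : (ℓ : Level) → Set (lsuc ℓ)
  Pred ℓ = St → Set ℓ

  Rel : (ℓ : Level) → Set (lsuc ℓ)
  Rel ℓ = St → St → Set ℓ

  _⊆_ : ∀ {a b} → Pred a → Pred b → Set (a ⊔ b)
  P ⊆ Q = ∀ σ → P σ → Q σ

  _⊆ᵣ_ : ∀ {a b} → Rel a → Rel b → Set (a ⊔ b)
  R ⊆ᵣ R' = ∀ σ σ' → R σ σ' → R' σ σ'

  _∩_ : ∀ {a b} → Pred a → Pred b → Pred (a ⊔ b)
  (P ∩ Q) σ = P σ × Q σ

  _⨾_ : ∀ {a b} → Rel a → Rel b → Rel (a ⊔ b)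
  (R ⨾ R') σ σ'' = ∃[ σ' ] (R σ σ' × R' σ' σ'')

  wlp : ∀ {a b} → Rel a → Pred b → Pred (a ⊔ b)
  wlp R P σ = ∀ σ' → R σ σ' → P σ'

  dis : ∀ {a} → Rel a → Pred a
  dis {a} R = wlp {b = a} R (λ _ → ⊥)

record Setting : Set₁ where
  field
    Thread Var Val Reg : Set
    St     : Set
    ActExt : Set
    I      : St → Set
    T      : Thread → ActExt → St → St → Set
    var       : ActExt → Maybe Var
    fence     : ActExt
    var-fence : var fence ≡ nothing
    -- a ∈ Rd_{|x}[v] (reads of x returning v), a ∈ Rd^A_{|x}[v] (acquiring)
    Rd  : Var → Val → ActExt → Set
    RdA : Var → Val → ActExt → Set
    Rd-var  : ∀ {x v a} → Rd x v a → var a ≡ just x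
    RdA-var : ∀ {x v a} → RdA x v a → var a ≡ just x
    vmax   : Thread → ActExt → St → Set
    interf : Thread → ActExt → St → St → Set
    regs : St → Thread → Reg → Val

module _ (S : Setting) where
  open Setting S

  Tset : Thread → (ActExt → Set) → Rel {St} lzero
  Tset t A σ σ' = Σ[ a ∈ ActExt ] (A a × T t a σ σ')

  IsβCandidate : Rel {St} lzero → Set
  IsβCandidate R =
    (∀ t a → (R ⨾ T t a) ⊆ᵣ (T t a ⨾ R)) ×
    (∀ t a → vmax t a ⊆ wlp R (vmax t a))

  -- β: the weakest (largest) such R, i.e. the union of all of them
  β : Rel {St} (lsuc lzero)
  β σ σ' = Σ[ R ∈ Rel {St} lzero ] (IsβCandidate R × R σ σ')

  βStable : ∀ {ℓ} → Pred {St} ℓ → Set (lsuc lzero ⊔ ℓ)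
  βStable P = P ⊆ wlp β P

  FenceTriple : Pred {St} lzero → Thread → Pred {St} lzero → Set
  FenceTriple P t Q = P ⊆ wlp (T t fence) Q

  NotObs : Thread → Var → Val → Pred {St} lzero
  NotObs t x v = dis (Tset t (Rd x v))

  DefObs : Thread → Var → Val → Pred {St} lzero
  DefObs t x v σ = ∀ u → ¬ (u ≡ v) → NotObs t x u σ

  MaxView : Thread → Var → Pred {St} lzero
  MaxView t x σ = ∀ a → var a ≡ just x → vmax t a σ

  Obs : Thread → Var → Val → Pred {St} lzero
  Obs t x v = DefObs t x v ∩ MaxView t x

  CondObs : Thread → Var → Val → Var → Val → Pred {St} lzero
  CondObs t x u y v = wlp (Tset t (RdA x u)) (Obs t y v)

  data GAssn : Set where
    notObs  : Thread → Var → Val → GAssn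
    defObs  : Thread → Var → Val → GAssn
    maxView : Thread → Var → GAssn
    obs     : Thread → Var → Val → GAssn
    condObs : Thread → Var → Val → Var → Val → GAssn
    true′ false′ : GAssn
    _∧′_ _∨′_ : GAssn → GAssn → GAssn

  ⟦_⟧G : GAssn → Pred {St} lzero
  ⟦ notObs t x v ⟧G = NotObs t x v
  ⟦ defObs t x v ⟧G = DefObs t x v
  ⟦ maxView t x ⟧G = MaxView t x
  ⟦ obs t x v ⟧G = Obs t x v
  ⟦ condObs t x u y v ⟧G = CondObs t x u y v
  ⟦ true′ ⟧G = λ _ → ⊤
  ⟦ false′ ⟧G = λ _ → ⊥
  ⟦ G ∧′ H ⟧G = ⟦ G ⟧G ∩ ⟦ H ⟧G
  ⟦ G ∨′ H ⟧G σ = ⟦ G ⟧G σ ⊎ ⟦ H ⟧G σ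

  data AAssn : Set where
    glob : GAssn → AAssn
    bexp : Thread → ((Reg → Val) → Bool) → AAssn
    true′ false′ : AAssn
    ¬′_ : AAssn → AAssn
    _∧′_ _∨′_ _⇒′_ : AAssn → AAssn → AAssn

  ⟦_⟧A : AAssn → Pred {St} lzero
  ⟦ glob G ⟧A = ⟦ G ⟧G
  ⟦ bexp t e ⟧A σ = e (regs σ t) ≡ true
  ⟦ true′ ⟧A = λ _ → ⊤
  ⟦ false′ ⟧A = λ _ → ⊥
  ⟦ ¬′ P ⟧A σ = ¬ ⟦ P ⟧A σ
  ⟦ P ∧′ Q ⟧A = ⟦ P ⟧A ∩ ⟦ Q ⟧A
  ⟦ P ∨′ Q ⟧A σ = ⟦ P ⟧A σ ⊎ ⟦ Q ⟧A σ
  ⟦ P ⇒′ Q ⟧A σ = ⟦ P ⟧A σ → ⟦ Q ⟧A σ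

  C3 : Set₁
  C3 = ∀ t a → T t a ⊆ᵣ (β ⨾ (interf t a ⨾ β))

  SV1 : Set
  SV1 = ∀ t t' a b → ¬ (var a ≡ var b) →
        (interf t' b ⨾ T t a) ⊆ᵣ (T t a ⨾ interf t' b)

  SV2 : Set
  SV2 = ∀ t t' a b → ¬ (var a ≡ var b) →
        vmax t a ⊆ wlp (interf t' b) (vmax t a)

-- Every global assertion is preserved by any relation that commutes with the
-- transitions of memory actions and preserves their maximal views: definite
-- non-observations, maximal views and conditional observations are all phrased
-- through such transitions and views. Both β and interf(t, fence) are of this
-- kind (the latter by SV1 and SV2, since the fence touches no variable), and
-- by C3 a fence step factors through β ⨾ interf(t, fence) ⨾ β.
module Submission where

open import Defs
open import Data.Maybe using (just)
open import Data.Product using (_,_)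
open import Data.Sum using (inj₁; inj₂)
open import Relation.Binary.PropositionalEquality using (_≡_; _≢_; trans; sym)

module _ (S : Setting) where
  open Setting S

  Preserves : ∀ {ℓ a} → Rel {St} ℓ → Pred {St} a → Set _
  Preserves R P = P ⊆ wlp R P

  preserves-⨾ : ∀ {ℓ ℓ' a} {R : Rel ℓ} {R' : Rel ℓ'} {P : Pred a} →
                Preserves R P → Preserves R' P → Preserves (R ⨾ R') P
  preserves-⨾ pR pR' σ p σ'' (σ' , r , r') = pR' σ' (pR σ p σ' r) σ'' r'

  record ViewPreserving {ℓ} (R : Rel {St} ℓ) : Set ℓ where
    field
      commute  : ∀ t a {x} → var a ≡ just x → (R ⨾ T t a) ⊆ᵣ (T t a ⨾ R)
      keepVmax : ∀ t a {x} → var a ≡ just x → Preserves R (vmax t a)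

  module _ {ℓ} {R : Rel {St} ℓ} (vp : ViewPreserving R) where
    open ViewPreserving vp

    preserves-NotObs : ∀ t x v → Preserves R (NotObs S t x v)
    preserves-NotObs t x v σ ¬obs σ' r σ'' (a , rd , tr)
      with commute t a (Rd-var rd) σ σ'' (σ' , r , tr)
    ... | σ₀ , tr₀ , _ = ¬obs σ₀ (a , rd , tr₀)

    preserves-DefObs : ∀ t x v → Preserves R (DefObs S t x v)
    preserves-DefObs t x v σ def σ' r u u≢v =
      preserves-NotObs t x u σ (def u u≢v) σ' r

    preserves-MaxView : ∀ t x → Preserves R (MaxView S t x)
    preserves-MaxView t x σ max σ' r a a∈x = keepVmax t a a∈x σ (max a a∈x) σ' r

    preserves-Obs : ∀ t x v → Preserves R (Obs S t x v)
    preserves-Obs t x v σ (def , max) σ' r =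
      preserves-DefObs t x v σ def σ' r , preserves-MaxView t x σ max σ' r

    preserves-CondObs : ∀ t x u y v → Preserves R (CondObs S t x u y v)
    preserves-CondObs t x u y v σ cond σ' r σ'' (a , rd , tr)
      with commute t a (RdA-var rd) σ σ'' (σ' , r , tr)
    ... | σ₀ , tr₀ , r₀ = preserves-Obs t y v σ₀ (cond σ₀ (a , rd , tr₀)) σ'' r₀

    preserves-GAssn : ∀ G → Preserves R (⟦_⟧G S G)
    preserves-GAssn (notObs t x v)      = preserves-NotObs t x v
    preserves-GAssn (defObs t x v)      = preserves-DefObs t x v
    preserves-GAssn (maxView t x)       = preserves-MaxView t x
    preserves-GAssn (obs t x v)         = preserves-Obs t x v
    preserves-GAssn (condObs t x u y v) = preserves-CondObs t x u y v
    preserves-GAssn true′               = λ _ tt _ _ → tt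
    preserves-GAssn false′              = λ _ ()
    preserves-GAssn (G ∧′ H) σ (g , h) σ' r =
      preserves-GAssn G σ g σ' r , preserves-GAssn H σ h σ' r
    preserves-GAssn (G ∨′ H) σ (inj₁ g) σ' r = inj₁ (preserves-GAssn G σ g σ' r)
    preserves-GAssn (G ∨′ H) σ (inj₂ h) σ' r = inj₂ (preserves-GAssn H σ h σ' r)

  β-viewPreserving : ViewPreserving (β S)
  β-viewPreserving = record
    { commute  = λ { t a _ σ σ'' (σ' , (R , cand@(comm , _) , r) , tr) →
                     let σ₀ , tr₀ , r₀ = comm t a σ σ'' (σ' , r , tr)
                     in σ₀ , tr₀ , (R , cand , r₀) }
    ; keepVmax = λ { t a _ σ m σ' (R , (_ , keep) , r) → keep t a σ m σ' r }
    }

  GAssn-βStable : ∀ G → βStable S (⟦_⟧G S G)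
  GAssn-βStable = preserves-GAssn β-viewPreserving

  var≢var-fence : ∀ {a x} → var a ≡ just x → var a ≢ var fence
  var≢var-fence a∈x a∈fence with trans (trans (sym a∈x) a∈fence) var-fence
  ... | ()

  interf-fence-viewPreserving : SV1 S → SV2 S → ∀ t → ViewPreserving (interf t fence)
  interf-fence-viewPreserving sv1 sv2 t = record
    { commute  = λ t' a a∈x → sv1 t' t a fence (var≢var-fence a∈x)
    ; keepVmax = λ t' a a∈x → sv2 t' t a fence (var≢var-fence a∈x)
    }

lemma3 : (S : Setting) → C3 S → SV1 S → SV2 S →
    ∀ (G : GAssn S) (P : AAssn S) (t : Setting.Thread S) →
    FenceTriple S (⟦_⟧G S G ∩ ⟦_⟧A S P) t (⟦_⟧G S G)
lemma3 S c3 sv1 sv2 G _ t σ (g , _) σ' fence-step =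
  preserved-by-factorisation σ g σ' (c3 t (Setting.fence S) σ σ' fence-step)
  where
    preserved-by-factorisation :
      Preserves S (β S ⨾ (Setting.interf S t (Setting.fence S) ⨾ β S)) (⟦_⟧G S G)
    preserved-by-factorisation =
      preserves-⨾ S (GAssn-βStable S G)
        (preserves-⨾ S
          (preserves-GAssn S (interf-fence-viewPreserving S sv1 sv2 t) G)
          (GAssn-βStable S G))
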